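{- Let $\mathcal{R}$ be a representable signature. In the symmetric representable type system over $\mathcal{R}$, the permutation rule is admissible: if $\gamma \vdash s : a$ is derivable, where $\gamma$ has length $k$, and $\sigma \in S_k$, then $\gamma\cdot\sigma \vdash s : a$ is derivable.
   Context: For $n\in\mathbb{N}$, $[n]=\{1,\dots,n\}$ and $S_n$ is the symmetric group. For a list $\gamma = c_1,\dots,c_n$ and $\sigma\in S_n$, $\gamma\cdot\sigma = c_{\sigma(1)},\dots,c_{\sigma(n)}$. For $n_1,\dots,n_k$ with $n=\sum n_i$, an $(n_1,\dots,n_k)$-shuffle is a bijection $\sigma:\sum_i [n_i]\cong[n]$ whose restriction to each $[n_i]$ is monotone; for lists $\gamma_1,\dots,\gamma_k$, $\mathsf{shu}(\gamma_1,\dots,\gamma_k)$ is the set of $(|\gamma_1|,\dots,|\gamma_k|)$-shuffles, viewed as permutations of the concatenation. A representable signature consists of a set $\mathcal{A}$ of atoms and a multigraph $\mathcal{R}$ whose nodes (types) are generated by $a ::= o \in \mathcal{A} \mid (a_1 \otimes \cdots \otimes a_k)$ for $k \in \mathbb{N}$, with sets $\mathcal{R}(a_1,\dots,a_n;b)$ of multiarrows. Terms: $s,t ::= x \mid \langle s_1,\dots,s_k\rangle \mid s[x_1^{a_1},\dots,x_k^{a_k} := t] \mid f(s_1,\dots,s_n)$; in $s[\vec{x} := t]$ the $x_i$ are bound in $s$. Typing contexts are lists of distinct typed variables; contexts combined in a rule are disjoint. Symmetric representable typing rules: $x:a \vdash x:a$; if $\gamma_i \vdash s_i : a_i$ and $\sigma\in\mathsf{shu}(\gamma_1,\dots,\gamma_k)$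 then $(\gamma_1,\dots,\gamma_k)\cdot\sigma \vdash \langle s_1,\dots,s_k\rangle : (a_1\otimes\cdots\otimes a_k)$; if $\gamma \vdash t : (a_1 \otimes\cdots\otimes a_k)$, $\delta, x_1:a_1,\dots,x_k:a_k, \delta' \vdash s : b$ and $\sigma\in\mathsf{shu}(\delta,\gamma,\delta')$ then $(\delta,\gamma,\delta')\cdot\sigma \vdash s[x_1^{a_1},\dots,x_k^{a_k} := t] : b$; if $f\in\mathcal{R}(a_1,\dots,a_n;b)$, $\gamma_i\vdash s_i:a_i$ and $\sigma\in\mathsf{shu}(\gamma_1,\dots,\gamma_n)$ then $(\gamma_1,\dots,\gamma_n)\cdot\sigma\vdash f(s_1,\dots,s_n):b$. -}

module Defs where

open import Data.Nat using (ℕ; zero; suc; _∸_; _<ᵇ_; _<_)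
open import Data.Bool using (if_then_else_)
open import Data.Fin using (Fin; toℕ)
open import Data.List using (List; []; _∷_; _++_; concat; map; length; lookup; tabulate)
open import Data.List.Relation.Unary.Unique.Propositional using (Unique)
open import Data.Product using (_×_; proj₁; proj₂)
open import Function.Bundles using (_↔_; Inverse)
open import Relation.Binary.PropositionalEquality using (_≡_)

Perm : ℕ → Set
Perm n = Fin n ↔ Fin n

_·_ : {X : Set} (γ : List X) → Perm (length γ) → List X
γ · σ = tabulate (λ i → lookup γ (Inverse.to σ i))

block : List ℕ → ℕ → ℕ
block []       j = 0
block (n ∷ ns) j = if j <ᵇ n then 0 else suc (block ns (j ∸ n))

-- σ ∈ shu(γ₁,…,γₖ), where ns = (|γ₁|,…,|γₖ|) and σ is a permutation of the
-- concatenation (of length Σ nᵢ).  Under the action γ·σ (entry i is c_{σ(i)}),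
-- the entry c_j of the concatenation lands at position σ⁻¹(j); σ is a shuffle
-- iff this placement is monotone on each block [nᵢ].
IsShuffle : (ns : List ℕ) {n : ℕ} → Perm n → Set
IsShuffle ns {n} σ =
  (j j' : Fin n) → block ns (toℕ j) ≡ block ns (toℕ j') → toℕ j < toℕ j' →
  toℕ (Inverse.from σ j) < toℕ (Inverse.from σ j')

data Ty (A : Set) : Set where
  atom   : A → Ty A
  tensor : List (Ty A) → Ty A

record Signature : Set₁ where
  field
    Atom : Set
    Arr  : List (Ty Atom) → Ty Atom → Set

open Signature public

Var : Set
Var = ℕ

module _ (Σ : Signature) where

  Type : Set
  Type = Ty (Atom Σ)

  Ctx : Set
  Ctx = List (Var × Type)

  data Tm : Set where
    var : Var → Tm
    tup : List Tm → Tm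
    lett : Tm → List (Var × Type) → Tm → Tm            -- lett s xs t = s[x₁^{a₁},…,xₖ^{aₖ} := t]
    app : (as : List Type) (b : Type) → Arr Σ as b → List Tm → Tm

  Disjoint : List Ctx → Set
  Disjoint γs = Unique (map proj₁ (concat γs))

  mutual
    data _⊢_∶_ : Ctx → Tm → Type → Set where
      ax : (x : Var) (a : Type) → ((x Data.Product., a) ∷ []) ⊢ var x ∶ a
      ⊗I : (γs : List Ctx) (ss : List Tm) (as : List Type) →
           Derivs γs ss as → Disjoint γs →
           (σ : Perm (length (concat γs))) → IsShuffle (map length γs) σ →
           (concat γs · σ) ⊢ tup ss ∶ tensor as
      ⊗E : (γ δ δ' : Ctx) (xs : List (Var × Type)) (t s : Tm) (b : Type) →
           γ ⊢ t ∶ tensor (map proj₂ xs) →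
           (δ ++ xs ++ δ') ⊢ s ∶ b →
           Disjoint (δ ∷ γ ∷ δ' ∷ []) →
           (σ : Perm (length (concat (δ ∷ γ ∷ δ' ∷ [])))) →
           IsShuffle (map length (δ ∷ γ ∷ δ' ∷ [])) σ →
           (concat (δ ∷ γ ∷ δ' ∷ []) · σ) ⊢ lett s xs t ∶ b
      fE : (as : List Type) (b : Type) (f : Arr Σ as b)
           (γs : List Ctx) (ss : List Tm) →
           Derivs γs ss as → Disjoint γs →
           (σ : Perm (length (concat γs))) → IsShuffle (map length γs) σ →
           (concat γs · σ) ⊢ app as b f ss ∶ b

    data Derivs : List Ctx → List Tm → List Type → Set where
      []  : Derivs [] [] []
      _∷_ : {γ : Ctx} {s : Tm} {a : Type} {γs : List Ctx} {ss : List Tm} {as : List Type} →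
            γ ⊢ s ∶ a → Derivs γs ss as → Derivs (γ ∷ γs) (s ∷ ss) (a ∷ as)

-- Strengthen the claim: if γ ⊢ s : a and γ′ has distinct variables and the same entries as
-- γ, then γ′ ⊢ s : a.  In a rule whose conclusion interleaves
-- premise contexts γ₁,…,γₖ, restrict γ′ to the variables of each γᵢ: the restriction has
-- the same entries as γᵢ, so the induction hypothesis retypes the premise there, and it is
-- a sublist of γ′.  As γ′ is the union of these disjoint sublists, it is their
-- concatenation permuted by a map preserving the order inside each block, i.e. by a
-- shuffle, so the rule applies again.

module Submission where

open import Defs

open import Level using (0ℓ)
open import Data.Nat as ℕ using (ℕ; zero; suc; _+_; z≤n; s≤s)
import Data.Nat.Properties as ℕ
open import Data.Fin as Fin using (Fin; toℕ; cast)
import Data.Fin.Properties as Fin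
open import Data.Fin.Permutation
  using (Permutation; permutation; _∘ₚ_; flip; cast-id; ↔⇒≡; inverseˡ)
open import Data.Product using (Σ-syntax; ∃-syntax; _×_; _,_; proj₁; proj₂)
import Data.Product as Product
open import Data.Sum using (_⊎_; inj₁; inj₂)
import Data.Sum as Sum
open import Data.List using (List; []; _∷_; _++_; concat; map; length; lookup; tabulate; filter)
import Data.List.Properties as List
open import Data.List.Membership.Propositional using (_∈_)
open import Data.List.Membership.Propositional.Properties
  using (∈-lookup; ∈-tabulate⁺; ∈-tabulate⁻; ∈-filter⁺; ∈-filter⁻; ∈-map⁺; ∈-map⁻;
         ∈-concat⁺′; ∈-concat⁻′)
open import Data.List.Membership.DecPropositional ℕ._≟_ using (_∈?_)
open import Data.List.Relation.Unary.Any using (Any; here; there; index)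
open import Data.List.Relation.Unary.Any.Properties using (lookup-index)
open import Data.List.Relation.Unary.All as All using (All; []; _∷_)
import Data.List.Relation.Unary.All.Properties as All
open import Data.List.Relation.Unary.AllPairs as AllPairs using (AllPairs; []; _∷_)
import Data.List.Relation.Unary.AllPairs.Properties as AllPairs
open import Data.List.Relation.Unary.Unique.Propositional using (Unique)
open import Data.List.Relation.Binary.Subset.Propositional using (_⊆_)
import Data.List.Relation.Binary.Subset.Propositional.Properties as Subset
open import Data.List.Relation.Binary.Sublist.Propositional as Sublist
  using (_∷_; _∷ʳ_) renaming (_⊆_ to _⊑_)
import Data.List.Relation.Binary.Sublist.Propositional.Properties as Sublist
open import Function using (_∘_; _∘′_; _on_)
open import Function.Bundles using (Inverse)
open import Relation.Binary using (Rel; Symmetric; tri<; tri≈; tri>)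
open import Relation.Binary.PropositionalEquality
open import Relation.Nullary using (yes; no; contradiction)
open import Relation.Unary using (Pred)

private
  variable
    A B : Set
    R : Rel A 0ℓ
    x y : A
    xs ys xs′ ys′ : List A
    n : ℕ

AllPairs-lookup : AllPairs R xs → {i j : Fin (length xs)} → i Fin.< j → R (lookup xs i) (lookup xs j)
AllPairs-lookup (h ∷ _) {Fin.zero} {Fin.suc j} _ = All.lookup h (∈-lookup j)
AllPairs-lookup (_ ∷ t) {Fin.suc i} {Fin.suc j} (s≤s i<j) = AllPairs-lookup t i<j

AllPairs-lookup-≢ : Symmetric R → AllPairs R xs → {i j : Fin (length xs)} → i ≢ j →
                    R (lookup xs i) (lookup xs j)
AllPairs-lookup-≢ R-sym rs {i} {j} i≢j with Fin.<-cmp i j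
... | tri< i<j _ _ = AllPairs-lookup rs i<j
... | tri≈ _ i≡j _ = contradiction i≡j i≢j
... | tri> _ _ j<i = R-sym (AllPairs-lookup rs j<i)

Unique-lookup-injective : Unique xs → {i j : Fin (length xs)} → lookup xs i ≡ lookup xs j → i ≡ j
Unique-lookup-injective xs! {i} {j} eq with i Fin.≟ j
... | yes i≡j = i≡j
... | no i≢j = contradiction eq (AllPairs-lookup-≢ (_∘ sym) xs! i≢j)

Unique-index-irrelevant : Unique xs → (p q : x ∈ xs) → index p ≡ index q
Unique-index-irrelevant xs! p q =
  Unique-lookup-injective xs! (trans (sym (lookup-index p)) (lookup-index q))

AllPairs-++⁻ : ∀ xs → AllPairs R (xs ++ ys) →
               AllPairs R xs × AllPairs R ys × (∀ {x y} → x ∈ xs → y ∈ ys → R x y)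
AllPairs-++⁻ [] rs = [] , rs , λ ()
AllPairs-++⁻ (x ∷ xs) (h ∷ rs) with AllPairs-++⁻ xs rs
... | rxs , rys , across = All.++⁻ˡ xs h ∷ rxs , rys , λ
  { (here refl) y∈ys → All.lookup (All.++⁻ʳ xs h) y∈ys
  ; (there x∈xs) y∈ys → across x∈xs y∈ys }

AllPairs-++⁺-⊆ : AllPairs R (xs ++ ys) → AllPairs R xs′ → AllPairs R ys′ →
                 xs′ ⊆ xs → ys′ ⊆ ys → AllPairs R (xs′ ++ ys′)
AllPairs-++⁺-⊆ {xs = xs} rs rxs′ rys′ xs′⊆xs ys′⊆ys =
  AllPairs.++⁺ rxs′ rys′ (All.tabulate λ x∈ → All.tabulate λ y∈ → across (xs′⊆xs x∈) (ys′⊆ys y∈))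
  where across = proj₂ (proj₂ (AllPairs-++⁻ xs rs))

AllPairs-concat-map-⊆ : (f : List A → List A) → ∀ xss → AllPairs R (concat xss) →
                        All (λ xs → AllPairs R (f xs) × f xs ⊆ xs) xss →
                        AllPairs R (concat (map f xss))
AllPairs-concat-map-⊆ f [] _ [] = []
AllPairs-concat-map-⊆ f (xs ∷ xss) rs ((rfxs , fxs⊆xs) ∷ hs) =
  AllPairs-++⁺-⊆ rs rfxs (AllPairs-concat-map-⊆ f xss (proj₁ (proj₂ (AllPairs-++⁻ xs rs))) hs)
    fxs⊆xs (concat-map-⊆ xss (All.map proj₂ hs))
  where
  concat-map-⊆ : ∀ xss → All (λ xs → f xs ⊆ xs) xss → concat (map f xss) ⊆ concat xss
  concat-map-⊆ (xs ∷ xss) (s ∷ ss) = Subset.++⁺ s (concat-map-⊆ xss ss)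

∈⇒⊆-concat : ∀ {xss : List (List A)} → xs ∈ xss → xs ⊆ concat xss
∈⇒⊆-concat xs∈ x∈ = ∈-concat⁺′ x∈ xs∈

AllPairs-≢-on-injective : (f : A → B) → AllPairs (_≢_ on f) xs → x ∈ xs → y ∈ xs → f x ≡ f y → x ≡ y
AllPairs-≢-on-injective f _ (here refl) (here refl) _ = refl
AllPairs-≢-on-injective f (h ∷ _) (here refl) (there q) eq = contradiction eq (All.lookup h q)
AllPairs-≢-on-injective f (h ∷ _) (there p) (here refl) eq = contradiction (sym eq) (All.lookup h p)
AllPairs-≢-on-injective f (_ ∷ t) (there p) (there q) eq = AllPairs-≢-on-injective f t p q eq

Unique-⊆-singleton : ∀ x → Unique xs → xs ⊆ x ∷ [] → x ∈ xs → xs ≡ x ∷ []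
Unique-⊆-singleton {xs = []} x _ _ ()
Unique-⊆-singleton {xs = y ∷ []} x _ xs⊆[x] _ with xs⊆[x] (here refl)
... | here refl = refl
Unique-⊆-singleton {xs = y ∷ z ∷ _} x ((y≢z ∷ _) ∷ _) xs⊆[x] _
  with xs⊆[x] (here refl) | xs⊆[x] (there (here refl))
... | here refl | here refl = contradiction refl y≢z

·-⊆ : (σ : Perm (length xs)) → xs · σ ⊆ xs
·-⊆ σ x∈ with ∈-tabulate⁻ x∈
... | i , refl = ∈-lookup (Inverse.to σ i)

⊆-· : (σ : Perm (length xs)) → xs ⊆ xs · σ
⊆-· {xs = xs} σ x∈ = subst (_∈ xs · σ) lookup-to-from (∈-tabulate⁺ (Inverse.from σ (index x∈)))
  where
  lookup-to-from =
    trans (cong (lookup xs) (Inverse.strictlyInverseˡ σ (index x∈))) (sym (lookup-index x∈))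

AllPairs-· : AllPairs R xs → Symmetric R → (σ : Perm (length xs)) → AllPairs R (xs · σ)
AllPairs-· rs R-sym σ = AllPairs.tabulate⁺ λ i≢j → AllPairs-lookup-≢ R-sym rs (i≢j ∘ to-injective)
  where
  to-injective : ∀ {i j} → Inverse.to σ i ≡ Inverse.to σ j → i ≡ j
  to-injective eq = trans (sym (inverseˡ σ)) (trans (cong (Inverse.from σ) eq) (inverseˡ σ))

reindex : xs ⊆ ys → Fin (length xs) → Fin (length ys)
reindex xs⊆ys i = index (xs⊆ys (∈-lookup i))

lookup-reindex : (xs⊆ys : xs ⊆ ys) (i : Fin (length xs)) → lookup ys (reindex xs⊆ys i) ≡ lookup xs i
lookup-reindex xs⊆ys i = sym (lookup-index (xs⊆ys (∈-lookup i)))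

reindex-inverse : Unique ys → (xs⊆ys : xs ⊆ ys) (ys⊆xs : ys ⊆ xs) (j : Fin (length ys)) →
                  reindex xs⊆ys (reindex ys⊆xs j) ≡ j
reindex-inverse ys! xs⊆ys ys⊆xs j =
  Unique-lookup-injective ys! (trans (lookup-reindex xs⊆ys _) (lookup-reindex ys⊆xs j))

reindex-permutation : Unique xs → Unique ys → xs ⊆ ys → ys ⊆ xs → Permutation (length xs) (length ys)
reindex-permutation xs! ys! xs⊆ys ys⊆xs =
  permutation (reindex xs⊆ys) (reindex ys⊆xs)
    (reindex-inverse ys! xs⊆ys ys⊆xs) (reindex-inverse xs! ys⊆xs xs⊆ys)

tabulate-lookup∘cast : ∀ (xs : List A) (e : n ≡ length xs) → tabulate (lookup xs ∘ cast e) ≡ xs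
tabulate-lookup∘cast {n = zero}  []       e = refl
tabulate-lookup∘cast {n = suc n} (x ∷ xs) e =
  cong (x ∷_) (tabulate-lookup∘cast xs (ℕ.suc-injective e))

Unique-⊆⊇⇒· : Unique xs → Unique ys → (xs⊆ys : xs ⊆ ys) → ys ⊆ xs →
              Σ[ σ ∈ Perm (length xs) ] ys ≡ xs · σ ×
                (∀ i → toℕ (Inverse.from σ i) ≡ toℕ (reindex xs⊆ys i))
Unique-⊆⊇⇒· {xs = xs} {ys = ys} xs! ys! xs⊆ys ys⊆xs = σ , ys≡xs·σ , λ i → Fin.toℕ-cast _ _
  where
  π = reindex-permutation xs! ys! xs⊆ys ys⊆xs
  e = ↔⇒≡ π
  σ : Perm (length xs)
  σ = cast-id e ∘ₚ flip π
  ys≡xs·σ : ys ≡ xs · σ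
  ys≡xs·σ = sym (begin
    xs · σ                        ≡⟨ List.tabulate-cong (λ i → lookup-reindex ys⊆xs (cast e i)) ⟩
    tabulate (lookup ys ∘ cast e) ≡⟨ tabulate-lookup∘cast ys e ⟩
    ys                            ∎)
    where open ≡-Reasoning

block-< : ∀ ns {m} (k : Fin m) → block (m ∷ ns) (toℕ k) ≡ 0
block-< ns Fin.zero    = refl
block-< ns (Fin.suc k) = block-< ns k

block-+ : ∀ m ns k → block (m ∷ ns) (m + k) ≡ suc (block ns k)
block-+ zero    ns k = refl
block-+ (suc m) ns k = block-+ m ns k

block-++ˡ : ∀ (xs : List A) ns {j} (p : x ∈ xs) → j ≡ toℕ (index p) → block (length xs ∷ ns) j ≡ 0
block-++ˡ xs ns p refl = block-< ns (index p)

block-++ʳ : ∀ (xs : List A) ns {j k} → j ≡ length xs + k → block (length xs ∷ ns) j ≡ suc (block ns k)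
block-++ʳ xs ns refl = block-+ (length xs) ns _

index-++⁻ : ∀ xs (p : x ∈ xs ++ ys) →
            (Σ[ q ∈ x ∈ xs ] toℕ (index p) ≡ toℕ (index q)) ⊎
            (Σ[ q ∈ x ∈ ys ] toℕ (index p) ≡ length xs + toℕ (index q))
index-++⁻ []       p         = inj₂ (p , refl)
index-++⁻ (x ∷ xs) (here e)  = inj₁ (here e , refl)
index-++⁻ (x ∷ xs) (there p) =
  Sum.map (Product.map there (cong suc)) (Product.map₂ (cong suc)) (index-++⁻ xs p)

sameBlock⇒sameSegment : ∀ {P : Pred (List A) 0ℓ} xss → All P xss →
  (p : x ∈ concat xss) (q : y ∈ concat xss) →
  block (map length xss) (toℕ (index p)) ≡ block (map length xss) (toℕ (index q)) →
  index p Fin.< index q →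
  ∃[ xs ] P xs × Σ[ p′ ∈ x ∈ xs ] Σ[ q′ ∈ y ∈ xs ] index p′ Fin.< index q′
sameBlock⇒sameSegment (xs ∷ xss) (Pxs ∷ Pxss) p q same p<q with index-++⁻ xs p | index-++⁻ xs q
... | inj₁ (p′ , ep) | inj₁ (q′ , eq) = xs , Pxs , p′ , q′ , subst₂ ℕ._<_ ep eq p<q
... | inj₁ (p′ , ep) | inj₂ (q′ , eq) =
  contradiction (trans (sym (block-++ˡ xs ns p′ ep)) (trans same (block-++ʳ xs ns eq))) λ ()
  where ns = map length xss
... | inj₂ (p′ , ep) | inj₁ (q′ , eq) =
  contradiction (trans (sym (block-++ʳ xs ns ep)) (trans same (block-++ˡ xs ns q′ eq))) λ ()
  where ns = map length xss
... | inj₂ (p′ , ep) | inj₂ (q′ , eq) =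
  sameBlock⇒sameSegment xss Pxss p′ q′
    (ℕ.suc-injective (trans (sym (block-++ʳ xs ns ep)) (trans same (block-++ʳ xs ns eq))))
    (ℕ.+-cancelˡ-< (length xs) _ _ (subst₂ ℕ._<_ ep eq p<q))
  where ns = map length xss

index-lookup-< : ∀ {P Q : Pred A 0ℓ} (τ : xs ⊑ ys) {p : Any P xs} {q : Any Q xs} →
                 index p Fin.< index q → index (Sublist.lookup τ p) Fin.< index (Sublist.lookup τ q)
index-lookup-< (y ∷ʳ τ) p<q = s≤s (index-lookup-< τ p<q)
index-lookup-< (_ ∷ τ) {here _}  {here _}  ()
index-lookup-< (_ ∷ τ) {here _}  {there _} _          = s≤s z≤n
index-lookup-< (_ ∷ τ) {there _} {here _}  ()
index-lookup-< (_ ∷ τ) {there _} {there _} (s≤s p<q) = s≤s (index-lookup-< τ p<q)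

index-∈-lookup : ∀ (xs : List A) i → index (∈-lookup {xs = xs} i) ≡ i
index-∈-lookup (x ∷ xs) Fin.zero    = refl
index-∈-lookup (x ∷ xs) (Fin.suc i) = cong Fin.suc (index-∈-lookup xs i)

reindex-sameBlock-< : ∀ xss → Unique ys → All (_⊑ ys) xss → (c⊆ys : concat xss ⊆ ys) →
  {i j : Fin (length (concat xss))} →
  block (map length xss) (toℕ i) ≡ block (map length xss) (toℕ j) → i Fin.< j →
  reindex c⊆ys i Fin.< reindex c⊆ys j
reindex-sameBlock-< xss ys! τs c⊆ys {i} {j} same i<j =
  let _ , τ , p , q , p<q = sameBlock⇒sameSegment xss τs (∈-lookup i) (∈-lookup j) same′ i<j′
  in subst₂ Fin._<_ (Unique-index-irrelevant ys! (Sublist.lookup τ p) (c⊆ys (∈-lookup i)))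
                    (Unique-index-irrelevant ys! (Sublist.lookup τ q) (c⊆ys (∈-lookup j)))
                    (index-lookup-< τ p<q)
  where
  i≡ = index-∈-lookup (concat xss) i
  j≡ = index-∈-lookup (concat xss) j
  same′ = subst₂ (λ k l → block (map length xss) (toℕ k) ≡ block (map length xss) (toℕ l))
                 (sym i≡) (sym j≡) same
  i<j′ = subst₂ Fin._<_ (sym i≡) (sym j≡) i<j

interleaving⇒shuffle : ∀ xss → Unique (concat xss) → Unique ys →
  concat xss ⊆ ys → ys ⊆ concat xss → All (_⊑ ys) xss →
  Σ[ σ ∈ Perm (length (concat xss)) ] ys ≡ concat xss · σ × IsShuffle (map length xss) σ
interleaving⇒shuffle xss c! ys! c⊆ys ys⊆c τs with Unique-⊆⊇⇒· c! ys! c⊆ys ys⊆c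
... | σ , ys≡ , from≡ = σ , ys≡ , λ i j same i<j →
  subst₂ ℕ._<_ (sym (from≡ i)) (sym (from≡ j)) (reindex-sameBlock-< xss ys! τs c⊆ys same i<j)

module _ (𝓡 : Signature) where

  private
    variable
      γ γ′ δ δ′ ρ : Ctx 𝓡
      γs : List (Ctx 𝓡)
      s : Tm 𝓡
      b : Type 𝓡

  vars : Ctx 𝓡 → List Var
  vars = map proj₁

  DistinctVars : Ctx 𝓡 → Set
  DistinctVars = AllPairs (_≢_ on proj₁)

  DistinctVars⇒Unique : DistinctVars γ → Unique γ
  DistinctVars⇒Unique = AllPairs.map (λ x≢y → x≢y ∘ cong proj₁)

  Disjoint⇒DistinctVars : ∀ γs → Disjoint 𝓡 γs → DistinctVars (concat γs)
  Disjoint⇒DistinctVars γs = AllPairs.map⁻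

  DistinctVars⇒Disjoint : ∀ γs → DistinctVars (concat γs) → Disjoint 𝓡 γs
  DistinctVars⇒Disjoint γs = AllPairs.map⁺

  ⊢⇒DistinctVars : _⊢_∶_ 𝓡 γ s b → DistinctVars γ
  ⊢⇒DistinctVars (ax x a) = [] ∷ []
  ⊢⇒DistinctVars (⊗I γs _ _ _ disj σ _) =
    AllPairs-· (Disjoint⇒DistinctVars γs disj) (_∘ sym) σ
  ⊢⇒DistinctVars (⊗E γ δ δ′ _ _ _ _ _ _ disj σ _) =
    AllPairs-· (Disjoint⇒DistinctVars (δ ∷ γ ∷ δ′ ∷ []) disj) (_∘ sym) σ
  ⊢⇒DistinctVars (fE _ _ _ γs _ _ disj σ _) =
    AllPairs-· (Disjoint⇒DistinctVars γs disj) (_∘ sym) σ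

  restrict : Ctx 𝓡 → Ctx 𝓡 → Ctx 𝓡
  restrict γ δ = filter (λ e → proj₁ e ∈? vars δ) γ

  restrict-⊑ : ∀ γ δ → restrict γ δ ⊑ γ
  restrict-⊑ γ δ = Sublist.filter-⊆ (λ e → proj₁ e ∈? vars δ) γ

  restrict-DistinctVars : ∀ δ → DistinctVars γ → DistinctVars (restrict γ δ)
  restrict-DistinctVars δ = AllPairs.filter⁺ (λ e → proj₁ e ∈? vars δ)

  restrict-⊆ : DistinctVars γ → δ ⊆ γ → restrict γ δ ⊆ δ
  restrict-⊆ {γ} {δ} dγ δ⊆γ e∈ with ∈-filter⁻ (λ e → proj₁ e ∈? vars δ) {xs = γ} e∈
  ... | e∈γ , x∈δ with ∈-map⁻ proj₁ x∈δ
  ... | e′ , e′∈δ , x≡x′ =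
    subst (_∈ δ) (sym (AllPairs-≢-on-injective proj₁ dγ e∈γ (δ⊆γ e′∈δ) x≡x′)) e′∈δ

  ⊆-restrict : δ ⊆ γ → δ ⊆ restrict γ δ
  ⊆-restrict {δ} δ⊆γ e∈ = ∈-filter⁺ (λ e → proj₁ e ∈? vars δ) (δ⊆γ e∈) (∈-map⁺ proj₁ e∈)

  concat-restrict-⊆ : ∀ γs → concat (map (restrict γ) γs) ⊆ γ
  concat-restrict-⊆ {γ} γs e∈ with ∈-concat⁻′ (map (restrict γ) γs) e∈
  ... | ρ , e∈ρ , ρ∈ with ∈-map⁻ (restrict γ) ρ∈
  ... | δ , _ , refl = proj₁ (∈-filter⁻ (λ e → proj₁ e ∈? vars δ) {xs = γ} e∈ρ)

  ⊆-concat-restrict : ∀ γs → concat γs ⊆ γ → concat γs ⊆ concat (map (restrict γ) γs)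
  ⊆-concat-restrict {γ} γs c⊆γ e∈ with ∈-concat⁻′ γs e∈
  ... | δ , e∈δ , δ∈ =
    ∈⇒⊆-concat (∈-map⁺ (restrict γ) δ∈) (⊆-restrict (c⊆γ ∘′ ∈⇒⊆-concat δ∈) e∈δ)

  restrict-++-⊆ : DistinctVars γ′ → δ ⊆ γ′ → δ′ ⊆ γ′ →
                  restrict γ′ δ ++ ρ ++ restrict γ′ δ′ ⊆ δ ++ ρ ++ δ′
  restrict-++-⊆ dγ′ δ⊆γ′ δ′⊆γ′ =
    Subset.++⁺ (restrict-⊆ dγ′ δ⊆γ′) (Subset.++⁺ Subset.⊆-refl (restrict-⊆ dγ′ δ′⊆γ′))

  ⊆-restrict-++ : δ ⊆ γ′ → δ′ ⊆ γ′ → δ ++ ρ ++ δ′ ⊆ restrict γ′ δ ++ ρ ++ restrict γ′ δ′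
  ⊆-restrict-++ δ⊆γ′ δ′⊆γ′ =
    Subset.++⁺ (⊆-restrict δ⊆γ′) (Subset.++⁺ Subset.⊆-refl (⊆-restrict δ′⊆γ′))

  restrict-++-DistinctVars : DistinctVars γ′ → δ ⊆ γ′ → δ′ ⊆ γ′ → DistinctVars (δ ++ ρ ++ δ′) →
                             DistinctVars (restrict γ′ δ ++ ρ ++ restrict γ′ δ′)
  restrict-++-DistinctVars {δ = δ} {δ′ = δ′} {ρ = ρ} dγ′ δ⊆γ′ δ′⊆γ′ dbody
    with AllPairs-++⁻ δ dbody
  ... | _ , dρ++δ′ , _ =
    AllPairs-++⁺-⊆ dbody (restrict-DistinctVars δ dγ′)
      (AllPairs-++⁺-⊆ dρ++δ′ (proj₁ (AllPairs-++⁻ ρ dρ++δ′)) (restrict-DistinctVars δ′ dγ′)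
        Subset.⊆-refl (restrict-⊆ dγ′ δ′⊆γ′))
      (restrict-⊆ dγ′ δ⊆γ′) (Subset.++⁺ Subset.⊆-refl (restrict-⊆ dγ′ δ′⊆γ′))

  restrict-reshuffle : ∀ γs → Disjoint 𝓡 γs → DistinctVars γ′ → γ′ ⊆ concat γs → concat γs ⊆ γ′ →
    Disjoint 𝓡 (map (restrict γ′) γs) ×
    Σ[ σ ∈ Perm (length (concat (map (restrict γ′) γs))) ]
      γ′ ≡ concat (map (restrict γ′) γs) · σ × IsShuffle (map length (map (restrict γ′) γs)) σ
  restrict-reshuffle {γ′} γs disj dγ′ γ′⊆ ⊆γ′ =
    DistinctVars⇒Disjoint (map (restrict γ′) γs) dρs ,
    interleaving⇒shuffle (map (restrict γ′) γs) (DistinctVars⇒Unique dρs) (DistinctVars⇒Unique dγ′)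
      (concat-restrict-⊆ γs) (⊆-concat-restrict γs ⊆γ′ ∘′ γ′⊆)
      (All.map⁺ (All.tabulate {xs = γs} λ {δ} _ → restrict-⊑ γ′ δ))
    where
    dρs : DistinctVars (concat (map (restrict γ′) γs))
    dρs = AllPairs-concat-map-⊆ (restrict γ′) γs (Disjoint⇒DistinctVars γs disj)
            (All.tabulate λ δ∈ → restrict-DistinctVars _ dγ′ , restrict-⊆ dγ′ (⊆γ′ ∘′ ∈⇒⊆-concat δ∈))

  mutual
    exchange : _⊢_∶_ 𝓡 γ s b → DistinctVars γ′ → γ′ ⊆ γ → γ ⊆ γ′ → _⊢_∶_ 𝓡 γ′ s b
    exchange (ax x a) dγ′ γ′⊆ ⊆γ′ =
      subst (λ γ → _⊢_∶_ 𝓡 γ (var x) a)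
        (sym (Unique-⊆-singleton _ (DistinctVars⇒Unique dγ′) γ′⊆ (⊆γ′ (here refl)))) (ax x a)
    exchange (⊗I γs ss as ds disj σ _) dγ′ γ′⊆ ⊆γ′ =
      let disj′ , τ , γ′≡ , shuffle = restrict-reshuffle γs disj dγ′ (·-⊆ σ ∘′ γ′⊆) (⊆γ′ ∘′ ⊆-· σ)
      in subst (λ γ → _⊢_∶_ 𝓡 γ (tup ss) (tensor as)) (sym γ′≡)
           (⊗I _ ss as (exchange* ds dγ′ (⊆γ′ ∘′ ⊆-· σ)) disj′ τ shuffle)
    exchange (fE as b f γs ss ds disj σ _) dγ′ γ′⊆ ⊆γ′ =
      let disj′ , τ , γ′≡ , shuffle = restrict-reshuffle γs disj dγ′ (·-⊆ σ ∘′ γ′⊆) (⊆γ′ ∘′ ⊆-· σ)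
      in subst (λ γ → _⊢_∶_ 𝓡 γ (app as b f ss) b) (sym γ′≡)
           (fE as b f _ ss (exchange* ds dγ′ (⊆γ′ ∘′ ⊆-· σ)) disj′ τ shuffle)
    exchange {γ′ = γ′} (⊗E γ δ δ′ xs t s b dt ds disj σ _) dγ′ γ′⊆ ⊆γ′ =
      let disj′ , τ , γ′≡ , shuffle =
            restrict-reshuffle (δ ∷ γ ∷ δ′ ∷ []) disj dγ′ (·-⊆ σ ∘′ γ′⊆) (⊆γ′ ∘′ ⊆-· σ)
      in subst (λ γ → _⊢_∶_ 𝓡 γ (lett s xs t) b) (sym γ′≡)
           (⊗E (restrict γ′ γ) (restrict γ′ δ) (restrict γ′ δ′) xs t s b
             (exchange-restrict dt dγ′ (block⊆γ′ (there (here refl))))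
             (exchange-restrict-++ ds dγ′ (block⊆γ′ (here refl)) (block⊆γ′ (there (there (here refl)))))
             disj′ τ shuffle)
      where
      block⊆γ′ : ∀ {ρ} → ρ ∈ δ ∷ γ ∷ δ′ ∷ [] → ρ ⊆ γ′
      block⊆γ′ ρ∈ = ⊆γ′ ∘′ ⊆-· σ ∘′ ∈⇒⊆-concat ρ∈

    exchange-restrict : _⊢_∶_ 𝓡 δ s b → DistinctVars γ′ → δ ⊆ γ′ → _⊢_∶_ 𝓡 (restrict γ′ δ) s b
    exchange-restrict {δ = δ} d dγ′ δ⊆γ′ =
      exchange d (restrict-DistinctVars δ dγ′) (restrict-⊆ dγ′ δ⊆γ′) (⊆-restrict δ⊆γ′)

    exchange-restrict-++ : _⊢_∶_ 𝓡 (δ ++ ρ ++ δ′) s b → DistinctVars γ′ → δ ⊆ γ′ → δ′ ⊆ γ′ →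
                           _⊢_∶_ 𝓡 (restrict γ′ δ ++ ρ ++ restrict γ′ δ′) s b
    exchange-restrict-++ d dγ′ δ⊆γ′ δ′⊆γ′ =
      exchange d (restrict-++-DistinctVars dγ′ δ⊆γ′ δ′⊆γ′ (⊢⇒DistinctVars d))
        (restrict-++-⊆ dγ′ δ⊆γ′ δ′⊆γ′) (⊆-restrict-++ δ⊆γ′ δ′⊆γ′)

    exchange* : ∀ {γs ss as} → Derivs 𝓡 γs ss as → DistinctVars γ′ → concat γs ⊆ γ′ →
                Derivs 𝓡 (map (restrict γ′) γs) ss as
    exchange* [] dγ′ _ = []
    exchange* (_∷_ {γ = δ} d ds) dγ′ c⊆γ′ =
      exchange-restrict d dγ′ (c⊆γ′ ∘′ Subset.xs⊆xs++ys δ _)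
      ∷ exchange* ds dγ′ (c⊆γ′ ∘′ Subset.xs⊆ys++xs _ δ)

proposition4p3 : (R : Signature) {γ : Ctx R} {s : Tm R} {a : Type R} →
    _⊢_∶_ R γ s a → (σ : Perm (length γ)) → _⊢_∶_ R (γ · σ) s a
proposition4p3 R d σ =
  exchange R d (AllPairs-· (⊢⇒DistinctVars R d) (_∘ sym) σ) (·-⊆ σ) (⊆-· σ)
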